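{- Let $F\colon\mathbf{Set}\to\mathbf{Set}$ be a functor preserving weak pullbacks that has a separating set of monotone predicate liftings, let $\alpha\colon X\to FX$ be a coalgebra with $X$ finite, and let $R_n,T,I$ be the output of the partition refinement algorithm described in the context. Define formulas $\varphi_{x_0,x_1}$ for $(x_0,x_1)\notin R_n$ by the simplified construction in the context (with an arbitrary choice of the representative $x_0'\in P$ at each step). Then $x_0\models\varphi_{x_0,x_1}$ and $x_1\not\models\varphi_{x_0,x_1}$.
   Context: Lifted order: for a preorder $\le$ on $Y$, $t_0\le^F t_1$ in $FY$ iff there is $t\in F(\le)$ with $F\pi_i(t)=t_i$, $\pi_i\colon{\le}\to Y$ the projections; we use $2=\{0,1\}$, $0\le 1$. An evaluation map $\lambda\colon F2\to2$ induces the predicate lifting $p\mapsto\lambda\circ Fp$; monotone means monotone w.r.t. $\le^F$; a set $\Lambda$ of evaluation maps is separating if for all sets $X$ and $t_0\neq t_1\in FX$ there exist $\lambda\in\Lambda$, $p\colon X\to2$ with $\lambda(Fp(t_0))\ne\lambda(Fp(t_1))$. $\chi_P$ is the characteristic function of $P$; $E(R)$ is the set of classes of an equivalence relation $R$. Modal logic: formulas $\phi::=\bigwedge\Phi\mid\neg\phi\mid[\lambda]\phi$ for sets $\Phi$ of formulas and evaluation maps $\lambda$; semantics $[\![\phi]\!]\colon X\to2$ with conjunction/negation as usual and $[\![[\lambda]\phi]\!]=\lambda\circ F[\![\phi]\!]\circ\alpha$; $x\models\phi$ iff $[\![\phi]\!](x)=1$; $\mathit{tt}$ is the empty conjunction.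 For $v\in F2$ the cone modality $\uparrow v\colon F2\to 2$ is $\uparrow v(u)=1$ iff $v\le^F u$. Algorithm: initially $I(x,y)=\infty$ for all pairs, $R_0=X\times X$, $i=0$. Repeat: $i:=i+1$, $R_i:=R_{i-1}$; for every $(x,y)\in R_{i-1}$ and $P\in E(R_{i-1})$: if $F\chi_P(\alpha(x))\not\le^F F\chi_P(\alpha(y))$, set $T(x,y):=(x,P)$, $I(x,y):=i$, remove $(x,y)$ from $R_i$; else if $F\chi_P(\alpha(y))\not\le^F F\chi_P(\alpha(x))$, set $T(x,y):=(y,P)$, $I(x,y):=i$, remove $(x,y)$ from $R_i$. Stop when $R_i=R_{i-1}$; $R_n$ is the final relation. Simplified construction of $\varphi_{x_0,x_1}$ for $(x_0,x_1)\notin R_n$, by recursion on $I(x_0,x_1)$: let $T(x_0,x_1)=(s,P)$. Define $\phi=\mathit{tt}$ if $I(x_0,x_1)=1$, and, if $I(x_0,x_1)>1$, choose some $x_0'\in P$ and set $\phi=\bigwedge_{x_1'\in X\setminus P}\varphi_{x_0',x_1'}$. If $s=x_0$, let $v=F\chi_P(\alpha(x_0))$ and $\varphi_{x_0,x_1}=[\uparrow v]\phi$; if $s=x_1$, let $v=F\chi_P(\alpha(x_1))$ and $\varphi_{x_0,x_1}=\neg[\uparrow v]\phi$. -}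

module Defs where

open import Level using (Level) renaming (suc to lsuc; zero to lzero)
open import Data.Bool using (Bool; true; false; not; _≤_)
open import Data.Nat using (ℕ; zero; suc; pred; _<_) renaming (_≤_ to _≤ℕ_)
open import Data.Maybe using (Maybe; just; nothing)
open import Data.Product using (Σ; Σ-syntax; _×_; _,_; proj₁; proj₂)
open import Data.Sum using (_⊎_; inj₁; inj₂)
open import Data.Unit using (⊤; tt)
open import Data.Empty using (⊥; ⊥-elim)
open import Function using (_∘_; id)
open import Relation.Nullary using (¬_; Dec; does)
open import Relation.Binary.PropositionalEquality using (_≡_; _≢_)

-- Endofunctors on Set (functor laws stated pointwise; fmap-cong replaces
-- function extensionality).

record SetFunctor : Set₁ where
  field
    F₀        : Set → Set
    fmap      : {A B : Set} → (A → B) → F₀ A → F₀ B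
    fmap-id   : {A : Set} (t : F₀ A) → fmap id t ≡ t
    fmap-∘    : {A B C : Set} (f : A → B) (g : B → C) (t : F₀ A) →
                fmap (g ∘ f) t ≡ fmap g (fmap f t)
    fmap-cong : {A B : Set} {f g : A → B} → (∀ a → f a ≡ g a) →
                (t : F₀ A) → fmap f t ≡ fmap g t

IsWeakPullback : {A B C P : Set} (f : A → C) (g : B → C)
                 (p₁ : P → A) (p₂ : P → B) → Set
IsWeakPullback {A} {B} {C} {P} f g p₁ p₂ =
  ((z : P) → f (p₁ z) ≡ g (p₂ z)) ×
  ((a : A) (b : B) → f a ≡ g b → Σ[ z ∈ P ] (p₁ z ≡ a × p₂ z ≡ b))

module _ (F : SetFunctor) where
  open SetFunctor F

  PreservesWeakPullbacks : Set₁
  PreservesWeakPullbacks =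
    {A B C P : Set} (f : A → C) (g : B → C) (p₁ : P → A) (p₂ : P → B) →
    IsWeakPullback f g p₁ p₂ →
    IsWeakPullback (fmap f) (fmap g) (fmap p₁) (fmap p₂)

  Lifted : {Y : Set} (_≼_ : Y → Y → Set) → F₀ Y → F₀ Y → Set
  Lifted {Y} _≼_ t₀ t₁ =
    Σ[ t ∈ F₀ (Σ[ p ∈ Y × Y ] (proj₁ p ≼ proj₂ p)) ]
      (fmap (proj₁ ∘ proj₁) t ≡ t₀ × fmap (proj₂ ∘ proj₁) t ≡ t₁)

  _≤F_ : F₀ Bool → F₀ Bool → Set
  _≤F_ = Lifted _≤_

  EvalMap : Set
  EvalMap = F₀ Bool → Bool

  Monotone : EvalMap → Set
  Monotone λ' = (u v : F₀ Bool) → u ≤F v → λ' u ≤ λ' v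

  Separating : (EvalMap → Set) → Set₁
  Separating Λ = (Y : Set) (t₀ t₁ : F₀ Y) → t₀ ≢ t₁ →
    Σ[ λ' ∈ EvalMap ] (Λ λ' × Σ[ p ∈ (Y → Bool) ]
      (λ' (fmap p t₀) ≢ λ' (fmap p t₁)))

  HasSeparatingMonotoneLiftings : Set₁
  HasSeparatingMonotoneLiftings =
    Σ[ Λ ∈ (EvalMap → Set) ] (((λ' : EvalMap) → Λ λ' → Monotone λ') × Separating Λ)

  data Form : Set₁ where
    ⋀    : (J : Set) → (J → Form) → Form
    ¬'   : Form → Form
    [_]_ : EvalMap → Form → Form

  ttF : Form
  ttF = ⋀ ⊥ ⊥-elim

  -- Classical semantics, using a decision oracle for propositions
  -- (needed for infinitary conjunction and the cone modality).
  module Semantics (lem : (A : Set) → Dec A) where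

    ⟦_⟧ : Form → {X : Set} → (X → F₀ X) → X → Bool
    ⟦ ⋀ J φs ⟧ α x = does (lem ((j : J) → ⟦ φs j ⟧ α x ≡ true))
    ⟦ ¬' φ ⟧ α x = not (⟦ φ ⟧ α x)
    ⟦ [ λ' ] φ ⟧ α x = λ' (fmap (⟦ φ ⟧ α) (α x))

    _,_⊨_ : {X : Set} → (X → F₀ X) → X → Form → Set
    α , x ⊨ φ = ⟦ φ ⟧ α x ≡ true

    ↑ : F₀ Bool → EvalMap
    ↑ v u = does (lem (v ≤F u))

  -- Partition refinement algorithm (relational specification of its runs)

  module Algorithm {X : Set} (α : X → F₀ X) where

    IsClass : (X → X → Set) → (X → Bool) → Set
    IsClass R χ = Σ[ z ∈ X ] ((w : X) → (χ w ≡ true → R z w) × (R z w → χ w ≡ true))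

    R : ℕ → X → X → Set
    R zero    x y = ⊤
    R (suc i) x y = R i x y × ((χ : X → Bool) → IsClass (R i) χ →
      (fmap χ (α x) ≤F fmap χ (α y)) × (fmap χ (α y) ≤F fmap χ (α x)))

    data Side : Set where
      first second : Side

    _⊆R_ : (X → X → Set) → (X → X → Set) → Set
    S ⊆R S' = (x y : X) → S x y → S' x y

    -- A possible output (R_n, T, I) of the algorithm; I x y ≡ nothing is ∞.
    -- T x y = (first , P) encodes (x , P) and (second , P) encodes (y , P).
    record Output : Set₁ where
      field
        n       : ℕ
        n-pos   : 1 ≤ℕ n
        stops   : R (pred n) ⊆R R n
        first-stop : (i : ℕ) → 1 ≤ℕ i → i < n → ¬ (R (pred i) ⊆R R i)
        I       : X → X → Maybe ℕ
        T       : X → X → Side × (X → Bool)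
        I-just  : (x y : X) (i : ℕ) → I x y ≡ just i →
                  1 ≤ℕ i × i ≤ℕ n × R (pred i) x y × ¬ R i x y
        I-nothing : (x y : X) → I x y ≡ nothing → R n x y
        T-spec  : (x y : X) (i : ℕ) → I x y ≡ just i →
                  IsClass (R (pred i)) (proj₂ (T x y)) ×
                  ((proj₁ (T x y) ≡ first ×
                     ¬ (fmap (proj₂ (T x y)) (α x) ≤F fmap (proj₂ (T x y)) (α y)))
                   ⊎ (proj₁ (T x y) ≡ second ×
                     (fmap (proj₂ (T x y)) (α x) ≤F fmap (proj₂ (T x y)) (α y)) ×
                     ¬ (fmap (proj₂ (T x y)) (α y) ≤F fmap (proj₂ (T x y)) (α x))))

    IsChoice : Output → (X → X → X) → Set
    IsChoice out c = (x₀ x₁ : X) (i : ℕ) → Output.I out x₀ x₁ ≡ just (suc (suc i)) →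
      proj₂ (Output.T out x₀ x₁) (c x₀ x₁) ≡ true

    -- The simplified construction of φ_{x₀,x₁}, by recursion on I(x₀,x₁).
    -- `fuel` is only a termination measure: started at I(x₀,x₁), it never
    -- runs out on a genuine output since I decreases along recursive calls.
    module Construction (lem : (A : Set) → Dec A) (out : Output) (c : X → X → X) where
      open Output out
      open Semantics lem using (↑)

      φ-fuel : ℕ → X → X → Form
      φ-fuel zero x₀ x₁ = ttF
      φ-fuel (suc f) x₀ x₁ = build (I x₀ x₁) (T x₀ x₁)
        where
        body : ℕ → (X → Bool) → Form
        body (suc (suc _)) P =
          ⋀ (Σ[ x₁' ∈ X ] (P x₁' ≡ false)) (λ p → φ-fuel f (c x₀ x₁) (proj₁ p))
        body _ P = ttF
        build : Maybe ℕ → Side × (X → Bool) → Form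
        build nothing  _              = ttF
        build (just i) (first  , P)   = [ ↑ (fmap P (α x₀)) ] body i P
        build (just i) (second , P)   = ¬' ([ ↑ (fmap P (α x₁)) ] body i P)

      fuelOf : Maybe ℕ → ℕ
      fuelOf nothing  = 0
      fuelOf (just i) = i

      φ : X → X → Form
      φ x₀ x₁ = φ-fuel (fuelOf (I x₀ x₁)) x₀ x₁

module Submission where

-- Say that a formula φ *separates* x₀ from x₁ at level j if
-- x₀ ⊨ φ, x₁ ⊭ φ, and the truth value of φ is constant on R_j-classes.
-- We show, by induction on the recursion depth (the fuel) of the
-- construction, that φ_{x₀,x₁} separates x₀ from x₁ at level I(x₀,x₁).
--
-- 1. Since F preserves weak pullbacks, the lifted order ≤^F is reflexive
--    and transitive; consequently each R_i is an equivalence relation and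
--    a cone value ↑v(Fχ_P(α a)) only depends on the R_{i+1}-class of a.
-- 2. If I(x₀,x₁) = j and x₁' ∉ P for an R_{j-1}-class P ∋ x₀', then
--    I(x₀',x₁') < j, so by induction φ_{x₀',x₁'} separates x₀' from x₁'
--    at level j-1; the conjunction of these formulas then defines P.
-- 3. Guarding a formula that defines P by the cone modality ↑v (negated
--    when T chose the second state) yields a formula separating x₀ from x₁
--    at level j, because T(x₀,x₁) was selected by a failure of ≤^F.

open import Defs
open import Data.Nat using (ℕ)
open import Data.Fin using (Fin)
open import Data.Product using (_×_)
open import Relation.Nullary using (¬_; Dec)
open import Function.Bundles using (_↔_)

open import Data.Nat using (zero; suc; _≤?_; _≤′_; ≤′-refl; ≤′-step)
  renaming (_≤_ to _≤ℕ_)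
open import Data.Nat.Properties using (≤⇒≤′; <⇒≤pred; ≰⇒>; ≤-pred; n≤1+n)
  renaming (≤-trans to ≤ℕ-trans; ≤-refl to ≤ℕ-refl)
open import Data.Bool using (Bool; true; false; not)
import Data.Bool.Properties as Bool
open import Data.Maybe using (just; nothing)
open import Data.Product using (Σ; Σ-syntax; _,_; proj₁; proj₂; swap)
open import Data.Sum using (inj₁; inj₂)
open import Function using (_∘_)
open import Function.Bundles using (mk⇔)
open import Relation.Binary.Definitions using (Reflexive; Transitive)
open import Relation.Nullary using (yes; no; contradiction)
open import Relation.Nullary.Decidable using (dec-true; dec-false; does-⇔)
open import Relation.Binary.PropositionalEquality hiding ([_])

module LiftedOrder (F : SetFunctor) (pwp : PreservesWeakPullbacks F) where
  open SetFunctor F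

  module _ {Y : Set} {_≼_ : Y → Y → Set} where

    Pairs : Set
    Pairs = Σ[ p ∈ Y × Y ] (proj₁ p ≼ proj₂ p)

    source target : Pairs → Y
    source = proj₁ ∘ proj₁
    target = proj₂ ∘ proj₁

    Lifted-refl : Reflexive _≼_ → Reflexive (Lifted F _≼_)
    Lifted-refl ≼-refl {t} =
      fmap diagonal t ,
      trans (sym (fmap-∘ diagonal source t)) (fmap-id t) ,
      trans (sym (fmap-∘ diagonal target t)) (fmap-id t)
      where
      diagonal : Y → Pairs
      diagonal y = (y , y) , ≼-refl

    Composable : Set
    Composable = Σ[ q ∈ Pairs × Pairs ] (target (proj₁ q) ≡ source (proj₂ q))

    composable-pullback :
      IsWeakPullback target source (proj₁ ∘ proj₁) (proj₂ ∘ proj₁)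
    composable-pullback = proj₂ , λ a b e → ((a , b) , e) , refl , refl

    -- Lifting a transitive relation gives a transitive relation: F maps the
    -- pullback above to a weak pullback, which glues the two witnesses.
    Lifted-trans : Transitive _≼_ → Transitive (Lifted F _≼_)
    Lifted-trans ≼-trans {t₀} {t₁} {t₂} (u , u₀ , u₁) (v , v₁ , v₂) =
      fmap compose w , w₀ , w₂
      where
      open ≡-Reasoning
      compose : Composable → Pairs
      compose ((((a , b) , a≼b) , ((b′ , c) , b′≼c)) , b≡b′) =
        (a , c) , ≼-trans a≼b (subst (_≼ c) (sym b≡b′) b′≼c)
      glued : Σ[ w ∈ F₀ Composable ]
                (fmap (proj₁ ∘ proj₁) w ≡ u × fmap (proj₂ ∘ proj₁) w ≡ v)
      glued = proj₂ (pwp target source _ _ composable-pullback) u v (trans u₁ (sym v₁))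
      w = proj₁ glued
      w₀ : fmap source (fmap compose w) ≡ t₀
      w₀ = begin
        fmap source (fmap compose w)             ≡⟨ sym (fmap-∘ compose source w) ⟩
        fmap (source ∘ proj₁ ∘ proj₁) w          ≡⟨ fmap-∘ (proj₁ ∘ proj₁) source w ⟩
        fmap source (fmap (proj₁ ∘ proj₁) w)     ≡⟨ cong (fmap source) (proj₁ (proj₂ glued)) ⟩
        fmap source u                            ≡⟨ u₀ ⟩
        t₀                                       ∎
      w₂ : fmap target (fmap compose w) ≡ t₂
      w₂ = begin
        fmap target (fmap compose w)             ≡⟨ sym (fmap-∘ compose target w) ⟩
        fmap (target ∘ proj₂ ∘ proj₁) w          ≡⟨ fmap-∘ (proj₂ ∘ proj₁) target w ⟩
        fmap target (fmap (proj₂ ∘ proj₁) w)     ≡⟨ cong (fmap target) (proj₂ (proj₂ glued)) ⟩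
        fmap target v                            ≡⟨ v₂ ⟩
        t₂                                       ∎

  ≤F-refl : {u : F₀ Bool} → _≤F_ F u u
  ≤F-refl = Lifted-refl Bool.≤-refl

  ≤F-trans : {u v w : F₀ Bool} → _≤F_ F u v → _≤F_ F v w → _≤F_ F u w
  ≤F-trans = Lifted-trans Bool.≤-trans

module Correctness
  (lem : (A : Set) → Dec A) (F : SetFunctor) (pwp : PreservesWeakPullbacks F)
  {X : Set} (α : X → SetFunctor.F₀ F X)
  (out : Algorithm.Output F α) (c : X → X → X) (choice : Algorithm.IsChoice F α out c)
  where
  open SetFunctor F
  open LiftedOrder F pwp using (≤F-refl; ≤F-trans)
  open Semantics F lem
  open Algorithm F α
  open Output out
  open Construction lem out c

  ↑-resp : {v u u′ : F₀ Bool} → _≤F_ F u u′ → _≤F_ F u′ u → ↑ v u ≡ ↑ v u′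
  ↑-resp u≤u′ u′≤u =
    does-⇔ (mk⇔ (λ h → ≤F-trans h u≤u′) (λ h → ≤F-trans h u′≤u)) (lem _) (lem _)

  -- Each R_i is an equivalence relation.
  R-sym : ∀ i {x y} → R i x y → R i y x
  R-sym zero    _ = _
  R-sym (suc i) (r , step) = R-sym i r , λ χ cl → swap (step χ cl)

  R-trans : ∀ i {x y w} → R i x y → R i y w → R i x w
  R-trans zero    _ _ = _
  R-trans (suc i) (r , step) (s , step′) = R-trans i r s , λ χ cl →
    ≤F-trans (proj₁ (step χ cl)) (proj₁ (step′ χ cl)) ,
    ≤F-trans (proj₂ (step′ χ cl)) (proj₂ (step χ cl))

  R-antitone : ∀ {i j x y} → i ≤ℕ j → R j x y → R i x y
  R-antitone = go ∘ ≤⇒≤′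
    where
    go : ∀ {i j x y} → i ≤′ j → R j x y → R i x y
    go ≤′-refl       r = r
    go (≤′-step i≤j) r = go i≤j (proj₁ r)

  class-related : ∀ {i χ x y} → IsClass (R i) χ → χ x ≡ true → χ y ≡ true → R i x y
  class-related {i} (z , spec) χx χy =
    R-trans i (R-sym i (proj₁ (spec _) χx)) (proj₁ (spec _) χy)

  class-unrelated : ∀ {i χ x y} → IsClass (R i) χ → χ x ≡ true → χ y ≡ false → ¬ R i x y
  class-unrelated {i} (z , spec) χx χy r =
    contradiction (trans (sym (proj₂ (spec _) (R-trans i (proj₁ (spec _) χx) r))) χy) λ ()

  -- States related by R_{i+1} have ≤^F-equivalent images under Fχ_P ∘ α
  -- for every R_i-class P, so no cone can tell them apart.
  cone-invariant : ∀ {i P a b} (v : F₀ Bool) → IsClass (R i) P → R (suc i) a b →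
    ↑ v (fmap P (α a)) ≡ ↑ v (fmap P (α b))
  cone-invariant {P = P} v cl (_ , step) = ↑-resp (proj₁ (step P cl)) (proj₂ (step P cl))

  separation-index : ∀ {m x y} → ¬ R m x y → m ≤ℕ n →
    Σ[ j ∈ ℕ ] (I x y ≡ just j × j ≤ℕ m)
  separation-index {m} {x} {y} ¬r m≤n with I x y in eI
  ... | nothing = contradiction (R-antitone m≤n (I-nothing x y eI)) ¬r
  ... | just j with j ≤? m
  ...   | yes j≤m = j , refl , j≤m
  ...   | no  j≰m = contradiction
      (R-antitone (<⇒≤pred (≰⇒> j≰m)) (proj₁ (proj₂ (proj₂ (I-just x y j eI))))) ¬r

  record Separates (j : ℕ) (φ : Form F) (x₀ x₁ : X) : Set where
    field
      holds     : ⟦ φ ⟧ α x₀ ≡ true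
      fails     : ⟦ φ ⟧ α x₁ ≡ false
      invariant : ∀ {a b} → R j a b → ⟦ φ ⟧ α a ≡ ⟦ φ ⟧ α b
  open Separates

  Separates-weaken : ∀ {i j φ x₀ x₁} → j ≤ℕ i → Separates j φ x₀ x₁ → Separates i φ x₀ x₁
  Separates-weaken j≤i sep = record
    { holds = holds sep ; fails = fails sep ; invariant = invariant sep ∘ R-antitone j≤i }

  Defines : Form F → (X → Bool) → Set
  Defines ψ P = ∀ w → ⟦ ψ ⟧ α w ≡ P w

  ⋀-defines-class : ∀ {i P x₀′} → IsClass (R i) P → P x₀′ ≡ true →
    (ψ : Σ[ x₁′ ∈ X ] (P x₁′ ≡ false) → Form F) →
    (∀ p → Separates i (ψ p) x₀′ (proj₁ p)) →
    Defines (⋀ (Σ[ x₁′ ∈ X ] (P x₁′ ≡ false)) ψ) P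
  ⋀-defines-class {i} {P} {x₀′} cl x₀′∈P ψ sep w with P w in Pw
  ... | true  = dec-true (lem _) λ p →
        trans (sym (invariant (sep p) (class-related cl x₀′∈P Pw))) (holds (sep p))
  ... | false = dec-false (lem _) λ all →
        contradiction (trans (sym (all (w , Pw))) (fails (sep (w , Pw)))) λ ()

  guard : Side → X → X → (X → Bool) → Form F → Form F
  guard first  x₀ x₁ P ψ = [ ↑ (fmap P (α x₀)) ] ψ
  guard second x₀ x₁ P ψ = ¬' ([ ↑ (fmap P (α x₁)) ] ψ)

  -- The failure of ≤^F that made the algorithm record T(x₀,x₁) = (s , P).
  Discriminates : Side → X → X → (X → Bool) → Set
  Discriminates first  x₀ x₁ P = ¬ (_≤F_ F (fmap P (α x₀)) (fmap P (α x₁)))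
  Discriminates second x₀ x₁ P = ¬ (_≤F_ F (fmap P (α x₁)) (fmap P (α x₀)))

  T-discriminates : ∀ {x₀ x₁ j} → I x₀ x₁ ≡ just j →
    Discriminates (proj₁ (T x₀ x₁)) x₀ x₁ (proj₂ (T x₀ x₁))
  T-discriminates {x₀} {x₁} {j} eI with proj₂ (T-spec x₀ x₁ j eI)
  ... | inj₁ (s≡first  , ≰)     = subst (λ s → Discriminates s x₀ x₁ (proj₂ (T x₀ x₁))) (sym s≡first) ≰
  ... | inj₂ (s≡second , _ , ≰) = subst (λ s → Discriminates s x₀ x₁ (proj₂ (T x₀ x₁))) (sym s≡second) ≰

  box-sem : ∀ {P} (λ′ : EvalMap F) (ψ : Form F) → Defines ψ P → ∀ w →
    ⟦ [ λ′ ] ψ ⟧ α w ≡ λ′ (fmap P (α w))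
  box-sem λ′ ψ ψ≗P w = cong λ′ (fmap-cong ψ≗P (α w))

  guard-separates : ∀ {i s x₀ x₁ P ψ} → IsClass (R i) P → Discriminates s x₀ x₁ P →
    Defines ψ P → Separates (suc i) (guard s x₀ x₁ P ψ) x₀ x₁
  guard-separates {s = first} {x₀} {x₁} {P} {ψ} cl ≰ ψ≗P = record
    { holds = trans (sem x₀) (dec-true (lem _) ≤F-refl)
    ; fails = trans (sem x₁) (dec-false (lem _) ≰)
    ; invariant = λ {a} {b} r → trans (sem a) (trans (cone-invariant v cl r) (sym (sem b)))
    }
    where
    v = fmap P (α x₀)
    sem = box-sem (↑ v) ψ ψ≗P
  guard-separates {s = second} {x₀} {x₁} {P} {ψ} cl ≰ ψ≗P = record
    { holds = trans (sem x₀) (cong not (dec-false (lem _) ≰))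
    ; fails = trans (sem x₁) (cong not (dec-true (lem _) ≤F-refl))
    ; invariant = λ {a} {b} r →
        trans (sem a) (trans (cong not (cone-invariant v cl r)) (sym (sem b)))
    }
    where
    v = fmap P (α x₁)
    sem : ∀ w → ⟦ guard second x₀ x₁ P ψ ⟧ α w ≡ not (↑ v (fmap P (α w)))
    sem w = cong not (box-sem (↑ v) ψ ψ≗P w)

  premise : ℕ → X → X → ℕ → (X → Bool) → Form F
  premise f x₀ x₁ (suc (suc _)) P =
    ⋀ (Σ[ x₁′ ∈ X ] (P x₁′ ≡ false)) (λ p → φ-fuel f (c x₀ x₁) (proj₁ p))
  premise f x₀ x₁ _ P = ttF F

  φ-fuel-unfold : ∀ f {x₀ x₁} j s {P} → I x₀ x₁ ≡ just j → T x₀ x₁ ≡ (s , P) →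
    φ-fuel (suc f) x₀ x₁ ≡ guard s x₀ x₁ P (premise f x₀ x₁ j P)
  φ-fuel-unfold f zero          first  eI eT rewrite eI | eT = refl
  φ-fuel-unfold f zero          second eI eT rewrite eI | eT = refl
  φ-fuel-unfold f (suc zero)    first  eI eT rewrite eI | eT = refl
  φ-fuel-unfold f (suc zero)    second eI eT rewrite eI | eT = refl
  φ-fuel-unfold f (suc (suc _)) first  eI eT rewrite eI | eT = refl
  φ-fuel-unfold f (suc (suc _)) second eI eT rewrite eI | eT = refl

  index-nonzero : ∀ {x y} → ¬ I x y ≡ just zero
  index-nonzero {x} {y} eI with I-just x y zero eI
  ... | () , _

  Sound : ℕ → Set
  Sound f = ∀ {x₀ x₁ j} → I x₀ x₁ ≡ just j → j ≤ℕ f → Separates j (φ-fuel f x₀ x₁) x₀ x₁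

  -- Under the induction hypothesis, the premise defines the class P chosen
  -- by T: for j = 1 the class is all of X, otherwise use ⋀-defines-class,
  -- as every x₁′ ∉ P was separated from c x₀ x₁ ∈ P strictly before round j.
  premise-defines : ∀ f {x₀ x₁ j} → Sound f → I x₀ x₁ ≡ just j → j ≤ℕ suc f →
    Defines (premise f x₀ x₁ j (proj₂ (T x₀ x₁))) (proj₂ (T x₀ x₁))
  premise-defines f {j = zero} _ eI _ = contradiction eI index-nonzero
  premise-defines f {x₀} {x₁} {suc zero} _ eI _ w =
    trans (dec-true (lem _) λ ()) (sym (proj₂ (proj₂ cl w) _))
    where cl = proj₁ (T-spec x₀ x₁ 1 eI)
  premise-defines f {x₀} {x₁} {suc (suc m)} sound eI j≤1+f =
    ⋀-defines-class cl x₀′∈P (λ p → φ-fuel f x₀′ (proj₁ p)) separated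
    where
    P   = proj₂ (T x₀ x₁)
    x₀′ = c x₀ x₁
    cl  = proj₁ (T-spec x₀ x₁ (suc (suc m)) eI)
    x₀′∈P : P x₀′ ≡ true
    x₀′∈P = choice x₀ x₁ m eI
    1+m≤n : suc m ≤ℕ n
    1+m≤n = ≤ℕ-trans (n≤1+n (suc m)) (proj₁ (proj₂ (I-just x₀ x₁ _ eI)))
    separated : ∀ p → Separates (suc m) (φ-fuel f x₀′ (proj₁ p)) x₀′ (proj₁ p)
    separated (x₁′ , x₁′∉P)
      with j′ , eI′ , j′≤1+m ← separation-index (class-unrelated cl x₀′∈P x₁′∉P) 1+m≤n =
      Separates-weaken j′≤1+m (sound eI′ (≤ℕ-trans j′≤1+m (≤-pred j≤1+f)))

  sound : ∀ f → Sound f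
  sound f       {j = zero}  eI _  = contradiction eI index-nonzero
  sound zero    {j = suc _} _  ()
  sound (suc f) {x₀} {x₁} {suc i} eI j≤1+f =
    subst (λ φ → Separates (suc i) φ x₀ x₁) (sym (φ-fuel-unfold f (suc i) _ eI refl))
      (guard-separates (proj₁ (T-spec x₀ x₁ (suc i) eI)) (T-discriminates eI)
        (premise-defines f (sound f) eI j≤1+f))

  distinguishes : ∀ {x₀ x₁} → ¬ R n x₀ x₁ → (α , x₀ ⊨ φ x₀ x₁) × ¬ (α , x₁ ⊨ φ x₀ x₁)
  distinguishes {x₀} {x₁} ¬r with j , eI , _ ← separation-index ¬r ≤ℕ-refl rewrite eI =
    holds sep , λ h → contradiction (trans (sym h) (fails sep)) λ ()
    where sep = sound j eI ≤ℕ-refl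

corollary1 : (lem : (A : Set) → Dec A) (F : SetFunctor) →
    PreservesWeakPullbacks F → HasSeparatingMonotoneLiftings F →
    (X : Set) (k : ℕ) → X ↔ Fin k → (α : X → SetFunctor.F₀ F X) →
    (out : Algorithm.Output F α) (c : X → X → X) → Algorithm.IsChoice F α out c →
    (x₀ x₁ : X) → ¬ Algorithm.R F α (Algorithm.Output.n out) x₀ x₁ →
    Semantics._,_⊨_ F lem α x₀ (Algorithm.Construction.φ F α lem out c x₀ x₁) ×
    ¬ Semantics._,_⊨_ F lem α x₁ (Algorithm.Construction.φ F α lem out c x₀ x₁)
corollary1 lem F pwp _ X _ _ α out c choice x₀ x₁ ¬r =
  Correctness.distinguishes lem F pwp α out c choice ¬r
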